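{- Let $\beta>1$ be a quadratic Pisot unit, i.e. the root $>1$ of $x^2-ax-1$ with $a$ a positive integer, and let $\alpha=-\beta^{ -1}$ be its algebraic conjugate. Then every rational number $q\in\mathbb{Q}\cap(-1,1)$ has an eventually periodic $\alpha$-adic expansion with no fractional part, i.e. there is a sequence $(s_i)_{i\ge0}$ of digits in $\{0,1,\dots,a\}$, eventually periodic, weakly admissible, with $q=\sum_{i\ge0}s_i\alpha^i$.
   Context: Here the Rényi expansion of $1$ in base $\beta$ is $\mathrm{d}_\beta(1)=a1$. An $\alpha$-adic expansion of a number $z$ is a sequence of digits $(x_i)_{i\ge -k}$ in $\{0,1,\dots,a\}$, written $\cdots x_1x_0\bullet x_{ -1}\cdots x_{ -k}$, with $z=\sum_{i\ge-k}x_i\alpha^i$, which is weakly admissible: every factor $x_jx_{j-1}$ of length $2$ (read from left to right) is lexicographically strictly smaller than $a1$, i.e. a digit $a$ is never immediately followed (to its right) by a nonzero digit. "No fractional part" means $x_i=0$ for $i<0$. Eventually periodic means $x_{i+p}=x_i$ for some $p\ge1$ and all sufficiently large $i$. -}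

module Defs where

open import Data.Nat as ℕ using (ℕ; zero; suc; _≤_)
open import Data.Rational as ℚ using (ℚ; 0ℚ; 1ℚ; _+_; _*_; -_)
open import Data.Product using (Σ; _×_; _,_)
open import Data.Integer using (+_)
open import Relation.Binary.PropositionalEquality using (_≡_)

-- The field ℚ(α), where α is the algebraic conjugate of β.
-- β is the root > 1 of x² - a x - 1; its conjugate α = -β⁻¹ is the other
-- root of the same polynomial, so α² = a α + 1.
-- An element  x + y α  is represented by the pair (x , y) of rationals;
-- since x² - a x - 1 is irreducible over ℚ for a ≥ 1 (a² + 4 is not a
-- square), this representation is unique, so _≡_ on pairs is equality in ℚ(α).
QA : Set
QA = ℚ × ℚ

module _ (a : ℕ) where

  natQ : ℕ → ℚ
  natQ n = (+ n) ℚ./ 1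

  embed : ℚ → QA
  embed q = q , 0ℚ

  αQ : QA
  αQ = 0ℚ , 1ℚ

  _⊕_ : QA → QA → QA
  (x , y) ⊕ (u , v) = (x + u) , (y + v)

  _⊖_ : QA → QA → QA
  (x , y) ⊖ (u , v) = (x + (- u)) , (y + (- v))

  -- (x + yα)(u + vα) = (xu + yv) + (xv + yu + a yv) α    using α² = aα + 1
  _⊗_ : QA → QA → QA
  (x , y) ⊗ (u , v) = (x * u + y * v) , (x * v + y * u + natQ a * (y * v))

  αpow : ℕ → QA
  αpow zero    = embed 1ℚ
  αpow (suc n) = αpow n ⊗ αQ

  digitSum : (ℕ → ℕ) → ℕ → ℕ → QA
  digitSum s m zero    = embed 0ℚ
  digitSum s m (suc n) = digitSum s m n ⊕ (embed (natQ (s (m ℕ.+ n))) ⊗ αpow n)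

  -- For a sequence s with s (i + p) ≡ s i for all i ≥ k (p ≥ 1) and |α| < 1,
  -- the series Σ_{i≥0} s_i α^i converges to the unique z ∈ ℚ(α) with
  --   (1 - α^p) z = (1 - α^p) A + α^k P,
  -- where A = Σ_{i<k} s_i α^i and P = Σ_{j<p} s_{k+j} α^j   (1 - α^p ≠ 0).
  EvPeriodicSumIs : (ℕ → ℕ) → ℕ → ℕ → QA → Set
  EvPeriodicSumIs s k p z =
    ((embed 1ℚ ⊖ αpow p) ⊗ z)
      ≡ (((embed 1ℚ ⊖ αpow p) ⊗ digitSum s 0 k) ⊕ (αpow k ⊗ digitSum s k p))

  Digits : (ℕ → ℕ) → Set
  Digits s = ∀ i → s i ≤ a

  -- weakly admissible: every factor s_{j+1} s_j is lexicographically < a1,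
  -- i.e. a digit a is never immediately followed (to its right) by a nonzero digit.
  WeaklyAdmissible : (ℕ → ℕ) → Set
  WeaklyAdmissible s = ∀ j → s (suc j) ≡ a → s j ≡ 0

  EventuallyPeriodic : (ℕ → ℕ) → ℕ → ℕ → Set
  EventuallyPeriodic s k p = (1 ≤ p) × (∀ i → k ≤ i → s (i ℕ.+ p) ≡ s i)

{-# OPTIONS --safe #-}
module Submission where

-- Write q = N / D.  Remainders are kept in ℤ[α] scaled by D: starting from
-- Z = N, the digit map Z ↦ (Z − D s) / α chooses the least digit s for which
-- the next remainder stays ≥ −D, where s ≤ a, and s < a right after a nonzero
-- digit (this is weak admissibility).  As a real number (α = −1/β) the
-- remainder stays in [−D, (a + 1) D]; under the conjugate embedding α ↦ β the
-- map is a contraction, so the remainder stays in [−2aD, 2aD].  An element of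
-- ℤ[α] that is bounded in both embeddings has bounded coordinates, so the
-- orbit of (remainder, last digit nonzero?) repeats, the digits are eventually
-- periodic, and telescoping Z_t = D s_t + α Z_{t+1} over the preperiod and one
-- period gives the value of the expansion.  Signs in ℤ[α] are decided without
-- real numbers: W ≥ 0 under α ↦ β iff α^n W has nonnegative coordinates for
-- some n, and Euclid's algorithm for β finds such an n for W or for −W.

open import Data.Bool.Base using (Bool; true; false)
open import Data.Empty using (⊥-elim)
open import Data.Fin as Fin using (Fin; toℕ; fromℕ<; combine)
import Data.Fin.Properties as FinP
open import Data.Integer as ℤ using (ℤ; +_; -[1+_]; +[1+_]; 0ℤ; 1ℤ; +≤+; +<+; ∣_∣)
import Data.Integer.Properties as ℤP
open import Algebra.Properties.AbelianGroup ℤP.+-0-abelianGroup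
  using () renaming (∙-cancelˡ to +-cancelˡ; ∙-cancelʳ to +-cancelʳ)
open import Data.Integer.Tactic.RingSolver using (solve)
open import Data.List.Base using (_∷_; [])
open import Data.Nat as ℕ using (ℕ; zero; suc; z≤n; s≤s; _∸_; _≤_)
open import Data.Nat.Coprimality using (Coprime)
open import Data.Nat.GeneralisedArithmetic using (fold; fold-+)
import Data.Nat.Properties as ℕP
open import Data.Product using (Σ; _×_; _,_; proj₁; proj₂; uncurry)
open import Data.Rational as ℚ using (ℚ; mkℚ; 0ℚ; 1ℚ; *<*)
open import Data.Rational.Literals using (fromℤ)
import Data.Rational.Properties as ℚP
open import Data.Rational.Unnormalised.Base using (mkℚᵘ; *≡*)
open import Data.Sum using (_⊎_; inj₁; inj₂; swap)
open import Function.Base using (_∘_; _$_)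
open import Relation.Binary.PropositionalEquality
  using (_≡_; refl; sym; trans; cong; cong₂; subst; subst₂; module ≡-Reasoning)

open import Defs

-- The ring ℤ[α]

-- ⟨ x , y ⟩ stands for x + y α.  A data type rather than a pair (which has η),
-- so that operations on ⟨ x , y ⟩ compute to integer expressions in each
-- coordinate, which the integer ring solver then normalises.  The solver does
-- not unfold definitions, hence identities are stated on explicit coordinates.
data ℤα : Set where
  ⟨_,_⟩ : ℤ → ℤ → ℤα

⟨,⟩-cong : ∀ {x x′ y y′} → x ≡ x′ → y ≡ y′ → ⟨ x , y ⟩ ≡ ⟨ x′ , y′ ⟩
⟨,⟩-cong = cong₂ ⟨_,_⟩

⟨,⟩-injective : ∀ {x x′ y y′} → ⟨ x , y ⟩ ≡ ⟨ x′ , y′ ⟩ → x ≡ x′ × y ≡ y′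
⟨,⟩-injective refl = refl , refl

re im : ℤα → ℤ
re ⟨ x , _ ⟩ = x
im ⟨ _ , y ⟩ = y

module Arithmetic (A : ℤ) where

  infixl 6 _+_ _-_
  infixl 7 _*_
  infix  8 -_
  infix  9 α^_

  [_] : ℤ → ℤα
  [ c ] = ⟨ c , 0ℤ ⟩

  α : ℤα
  α = ⟨ 0ℤ , 1ℤ ⟩

  _+_ : ℤα → ℤα → ℤα
  ⟨ x , y ⟩ + ⟨ u , v ⟩ = ⟨ x ℤ.+ u , y ℤ.+ v ⟩

  -_ : ℤα → ℤα
  - ⟨ x , y ⟩ = ⟨ ℤ.- x , ℤ.- y ⟩

  _-_ : ℤα → ℤα → ℤα
  W - V = W + - V

  _*_ : ℤα → ℤα → ℤα
  ⟨ x , y ⟩ * ⟨ u , v ⟩ = ⟨ x ℤ.* u ℤ.+ y ℤ.* v , x ℤ.* v ℤ.+ y ℤ.* u ℤ.+ A ℤ.* (y ℤ.* v) ⟩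

  β : ℤα
  β = [ A ] - α

  -- the automorphism exchanging the two roots α and β of x² − A x − 1
  σ : ℤα → ℤα
  σ ⟨ x , y ⟩ = ⟨ x ℤ.+ A ℤ.* y , ℤ.- y ⟩

  α^_ : ℕ → ℤα
  α^ zero  = [ 1ℤ ]
  α^ suc n = α^ n * α

  sumDigits : (ℕ → ℕ) → ℕ → ℕ → ℤα
  sumDigits s m zero    = [ 0ℤ ]
  sumDigits s m (suc n) = sumDigits s m n + [ + s (m ℕ.+ n) ] * α^ n

  Δ : ℤ
  Δ = A ℤ.* A ℤ.+ + 4

  *-identityˡ : ∀ W → [ 1ℤ ] * W ≡ W
  *-identityˡ ⟨ x , y ⟩ = ⟨,⟩-cong (solve xs) (solve xs)
    where xs = A ∷ x ∷ y ∷ []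

  *-comm : ∀ W V → W * V ≡ V * W
  *-comm ⟨ x , y ⟩ ⟨ u , v ⟩ = ⟨,⟩-cong (solve xs) (solve xs)
    where xs = A ∷ x ∷ y ∷ u ∷ v ∷ []

  *-assoc : ∀ W V U → W * V * U ≡ W * (V * U)
  *-assoc ⟨ x , y ⟩ ⟨ u , v ⟩ ⟨ p , r ⟩ = ⟨,⟩-cong (solve xs) (solve xs)
    where xs = A ∷ x ∷ y ∷ u ∷ v ∷ p ∷ r ∷ []

  *-distribˡ-+ : ∀ W V U → W * (V + U) ≡ W * V + W * U
  *-distribˡ-+ ⟨ x , y ⟩ ⟨ u , v ⟩ ⟨ p , r ⟩ = ⟨,⟩-cong (solve xs) (solve xs)
    where xs = A ∷ x ∷ y ∷ u ∷ v ∷ p ∷ r ∷ []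

  neg-distribʳ-* : ∀ W V → - (W * V) ≡ W * - V
  neg-distribʳ-* ⟨ x , y ⟩ ⟨ u , v ⟩ = ⟨,⟩-cong (solve xs) (solve xs)
    where xs = A ∷ x ∷ y ∷ u ∷ v ∷ []

  *-interchange : ∀ W V U T → W * V * (U * T) ≡ W * U * (V * T)
  *-interchange W V U T = begin
    W * V * (U * T)   ≡⟨ *-assoc W V (U * T) ⟩
    W * (V * (U * T)) ≡⟨ cong (W *_) (sym (*-assoc V U T)) ⟩
    W * (V * U * T)   ≡⟨ cong (λ X → W * (X * T)) (*-comm V U) ⟩
    W * (U * V * T)   ≡⟨ cong (W *_) (*-assoc U V T) ⟩
    W * (U * (V * T)) ≡⟨ *-assoc W U (V * T) ⟨
    W * U * (V * T)   ∎
    where open ≡-Reasoning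

  α-* : ∀ x y → α * ⟨ x , y ⟩ ≡ ⟨ y , x ℤ.+ A ℤ.* y ⟩
  α-* x y = ⟨,⟩-cong (solve xs) (solve xs)
    where xs = A ∷ x ∷ y ∷ []

  *-α : ∀ x y → ⟨ x , y ⟩ * α ≡ ⟨ y , x ℤ.+ A ℤ.* y ⟩
  *-α x y = ⟨,⟩-cong (solve xs) (solve xs)
    where xs = A ∷ x ∷ y ∷ []

  []-* : ∀ c x y → [ c ] * ⟨ x , y ⟩ ≡ ⟨ c ℤ.* x , c ℤ.* y ⟩
  []-* c x y = ⟨,⟩-cong (solve xs) (solve xs)
    where xs = A ∷ c ∷ x ∷ y ∷ []

  *-[] : ∀ x y c → ⟨ x , y ⟩ * [ c ] ≡ ⟨ x ℤ.* c , y ℤ.* c ⟩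
  *-[] x y c = ⟨,⟩-cong (solve xs) (solve xs)
    where xs = A ∷ c ∷ x ∷ y ∷ []

  α^-+ : ∀ m n → α^ (m ℕ.+ n) ≡ α^ m * α^ n
  α^-+ zero    n = sym (*-identityˡ (α^ n))
  α^-+ (suc m) n = begin
    α^ (m ℕ.+ n) * α   ≡⟨ cong (_* α) (α^-+ m n) ⟩
    α^ m * α^ n * α    ≡⟨ *-assoc (α^ m) (α^ n) α ⟩
    α^ m * (α^ n * α)  ≡⟨ cong (α^ m *_) (*-comm (α^ n) α) ⟩
    α^ m * (α * α^ n)  ≡⟨ *-assoc (α^ m) α (α^ n) ⟨
    α^ m * α * α^ n    ∎
    where open ≡-Reasoning

  σ-+ : ∀ W V → σ (W + V) ≡ σ W + σ V
  σ-+ ⟨ x , y ⟩ ⟨ u , v ⟩ = ⟨,⟩-cong (solve xs) (solve xs)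
    where xs = A ∷ x ∷ y ∷ u ∷ v ∷ []

  σ-* : ∀ W V → σ (W * V) ≡ σ W * σ V
  σ-* ⟨ x , y ⟩ ⟨ u , v ⟩ = ⟨,⟩-cong (solve xs) (solve xs)
    where xs = A ∷ x ∷ y ∷ u ∷ v ∷ []

  σ-neg : ∀ W → σ (- W) ≡ - σ W
  σ-neg ⟨ x , y ⟩ = ⟨,⟩-cong (solve (A ∷ x ∷ y ∷ [])) refl

  σ-[] : ∀ c → σ [ c ] ≡ [ c ]
  σ-[] c = ⟨,⟩-cong (solve (A ∷ c ∷ [])) refl

  coordinates-injective : ∀ {x y x′ y′} .{{_ : ℤ.NonZero Δ}} →
                          + 2 ℤ.* x ℤ.+ A ℤ.* y ≡ + 2 ℤ.* x′ ℤ.+ A ℤ.* y′ → Δ ℤ.* y ≡ Δ ℤ.* y′ →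
                          ⟨ x , y ⟩ ≡ ⟨ x′ , y′ ⟩
  coordinates-injective {x} {y} {x′} {y′} tr≡ Δy≡ with refl ← ℤP.*-cancelˡ-≡ Δ y y′ Δy≡ =
    ⟨,⟩-cong (ℤP.*-cancelˡ-≡ (+ 2) x x′ (+-cancelʳ (A ℤ.* y) _ _ tr≡)) refl

-- Signs in ℤ[α]

+-nonNeg : ∀ {i j} → 0ℤ ℤ.≤ i → 0ℤ ℤ.≤ j → 0ℤ ℤ.≤ i ℤ.+ j
+-nonNeg (+≤+ _) (+≤+ _) = +≤+ z≤n

*-nonNeg : ∀ {i j} → 0ℤ ℤ.≤ i → 0ℤ ℤ.≤ j → 0ℤ ℤ.≤ i ℤ.* j
*-nonNeg {+ m} {+ n} _ _ = subst (0ℤ ℤ.≤_) (ℤP.pos-* m n) (+≤+ z≤n)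

record Bounded (c t : ℤ) : Set where
  constructor bounded
  field
    upper : 0ℤ ℤ.≤ c ℤ.- t
    lower : 0ℤ ℤ.≤ c ℤ.+ t

module Positivity (A : ℤ) (1≤A : 1ℤ ℤ.≤ A) where

  open Arithmetic A

  0≤A : 0ℤ ℤ.≤ A
  0≤A = ℤP.≤-trans (+≤+ z≤n) 1≤A

  Cone : ℤα → Set
  Cone ⟨ x , y ⟩ = 0ℤ ℤ.≤ x × 0ℤ ℤ.≤ y

  cone-+ : ∀ {W V} → Cone W → Cone V → Cone (W + V)
  cone-+ {⟨ _ , _ ⟩} {⟨ _ , _ ⟩} (x , y) (u , v) = +-nonNeg x u , +-nonNeg y v

  cone-* : ∀ {W V} → Cone W → Cone V → Cone (W * V)
  cone-* {⟨ _ , _ ⟩} {⟨ _ , _ ⟩} (x , y) (u , v) =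
    +-nonNeg (*-nonNeg x u) (*-nonNeg y v) ,
    +-nonNeg (+-nonNeg (*-nonNeg x v) (*-nonNeg y u)) (*-nonNeg 0≤A (*-nonNeg y v))

  cone-α^ : ∀ n → Cone (α^ n)
  cone-α^ zero    = +≤+ z≤n , ℤP.≤-refl
  cone-α^ (suc n) = cone-* (cone-α^ n) (ℤP.≤-refl , +≤+ z≤n)

  α^-re+im-positive : ∀ n → 0ℤ ℤ.< re (α^ n) ℤ.+ im (α^ n)
  α^-re+im-positive zero    = +<+ (s≤s z≤n)
  α^-re+im-positive (suc n) = grow (α^ n) (cone-α^ n) (α^-re+im-positive n)
    where
    grow : ∀ W → Cone W → 0ℤ ℤ.< re W ℤ.+ im W → 0ℤ ℤ.< re (W * α) ℤ.+ im (W * α)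
    grow ⟨ x , y ⟩ (_ , 0≤y) 0<x+y =
      subst (λ V → 0ℤ ℤ.< re V ℤ.+ im V) (sym (*-α x y)) $ begin-strict
        0ℤ                    <⟨ 0<x+y ⟩
        x ℤ.+ y               ≤⟨ ℤP.i≤i+j (x ℤ.+ y) (A ℤ.* y) {{ℤ.nonNegative (*-nonNeg 0≤A 0≤y)}} ⟩
        x ℤ.+ y ℤ.+ A ℤ.* y   ≡⟨ solve (A ∷ x ∷ y ∷ []) ⟩
        y ℤ.+ (x ℤ.+ A ℤ.* y) ∎
      where open ℤP.≤-Reasoning

  -- 0≤ᶜ W says that W ≥ 0 under α ↦ β, the root > 1, where multiplication by
  -- α expands; 0≤ W says that W ≥ 0 as a real number, α being the root −1/β.
  infix 4 0≤ᶜ_ 0≤_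

  data 0≤ᶜ_ (W : ℤα) : Set where
    after : ∀ n → Cone (α^ n * W) → 0≤ᶜ W

  record 0≤_ (W : ℤα) : Set where
    constructor by-σ
    field
      σ-nonNeg : 0≤ᶜ σ W

  open 0≤_

  cone⇒0≤ᶜ : ∀ {W} → Cone W → 0≤ᶜ W
  cone⇒0≤ᶜ {W} c = after 0 (subst Cone (sym (*-identityˡ W)) c)

  0≤ᶜ-[] : ∀ {c} → 0ℤ ℤ.≤ c → 0≤ᶜ [ c ]
  0≤ᶜ-[] 0≤c = cone⇒0≤ᶜ (0≤c , ℤP.≤-refl)

  0≤ᶜ-α⁻¹ : ∀ {W V} → α * W ≡ V → 0≤ᶜ V → 0≤ᶜ W
  0≤ᶜ-α⁻¹ {W} refl (after n c) = after (suc n) (subst Cone (sym (*-assoc (α^ n) α W)) c)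

  0≤ᶜ-α⁻¹-neg : ∀ {W V} → α * W ≡ V → 0≤ᶜ - V → 0≤ᶜ - W
  0≤ᶜ-α⁻¹-neg {W} refl = 0≤ᶜ-α⁻¹ (sym (neg-distribʳ-* α W))

  cone-shift : ∀ {W} m n → Cone (α^ m * W) → Cone (α^ (n ℕ.+ m) * W)
  cone-shift {W} m n c = subst Cone (sym α^[n+m]*W≡α^n*[α^m*W]) (cone-* (cone-α^ n) c)
    where
    α^[n+m]*W≡α^n*[α^m*W] : α^ (n ℕ.+ m) * W ≡ α^ n * (α^ m * W)
    α^[n+m]*W≡α^n*[α^m*W] = trans (cong (_* W) (α^-+ n m)) (*-assoc (α^ n) (α^ m) W)

  0≤ᶜ-+ : ∀ {W V} → 0≤ᶜ W → 0≤ᶜ V → 0≤ᶜ W + V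
  0≤ᶜ-+ {W} {V} (after m p) (after n q) =
    after (n ℕ.+ m) (subst Cone (sym (*-distribˡ-+ (α^ (n ℕ.+ m)) W V))
      (cone-+ (cone-shift m n p) (subst (λ k → Cone (α^ k * V)) (ℕP.+-comm m n) (cone-shift n m q))))

  0≤ᶜ-* : ∀ {W V} → 0≤ᶜ W → 0≤ᶜ V → 0≤ᶜ W * V
  0≤ᶜ-* {W} {V} (after m p) (after n q) = after (m ℕ.+ n) (subst Cone (sym regroup) (cone-* p q))
    where
    regroup : α^ (m ℕ.+ n) * (W * V) ≡ α^ m * W * (α^ n * V)
    regroup = trans (cong (_* (W * V)) (α^-+ m n)) (*-interchange (α^ m) (α^ n) W V)

  0≤ᶜ-integral : ∀ {c} → 0≤ᶜ [ c ] → 0ℤ ℤ.≤ c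
  0≤ᶜ-integral {c} (after n cone) = scale (α^ n) (α^-re+im-positive n) cone
    where
    scale : ∀ W → 0ℤ ℤ.< re W ℤ.+ im W → Cone (W * [ c ]) → 0ℤ ℤ.≤ c
    scale ⟨ x , y ⟩ 0<x+y cone with subst Cone (*-[] x y c) cone
    ... | 0≤xc , 0≤yc = ℤP.*-cancelˡ-≤-pos 0ℤ c (x ℤ.+ y) {{ℤ.positive 0<x+y}} $ begin
      (x ℤ.+ y) ℤ.* 0ℤ      ≡⟨ ℤP.*-zeroʳ (x ℤ.+ y) ⟩
      0ℤ                    ≤⟨ +-nonNeg 0≤xc 0≤yc ⟩
      x ℤ.* c ℤ.+ y ℤ.* c   ≡⟨ solve (x ∷ y ∷ c ∷ []) ⟩
      (x ℤ.+ y) ℤ.* c       ∎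
      where open ℤP.≤-Reasoning

  0≤ᶜ-α : 0≤ᶜ α
  0≤ᶜ-α = cone⇒0≤ᶜ (ℤP.≤-refl , +≤+ z≤n)

  0≤ᶜ-α-A : 0≤ᶜ α - [ A ]
  0≤ᶜ-α-A = 0≤ᶜ-α⁻¹ α*[α-A]≡1 (0≤ᶜ-[] (+≤+ z≤n))
    where
    α*[α-A]≡1 : α * (α - [ A ]) ≡ [ 1ℤ ]
    α*[α-A]≡1 = ⟨,⟩-cong (solve (A ∷ [])) (solve (A ∷ []))

  0≤ᶜ-α-1 : 0≤ᶜ α - [ 1ℤ ]
  0≤ᶜ-α-1 = 0≤ᶜ-α⁻¹ α*[α-1]≡⟨1,A-1⟩ (cone⇒0≤ᶜ (+≤+ z≤n , ℤP.i≤j⇒0≤j-i 1≤A))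
    where
    α*[α-1]≡⟨1,A-1⟩ : α * (α - [ 1ℤ ]) ≡ ⟨ 1ℤ , A ℤ.- 1ℤ ⟩
    α*[α-1]≡⟨1,A-1⟩ = ⟨,⟩-cong (solve (A ∷ [])) (solve (A ∷ []))

  0≤ᶜ-1+β : 0≤ᶜ [ 1ℤ ] + β
  0≤ᶜ-1+β = subst 0≤ᶜ_ (sym 1+β≡[α-1]*[α-A]) (0≤ᶜ-* 0≤ᶜ-α-1 0≤ᶜ-α-A)
    where
    1+β≡[α-1]*[α-A] : [ 1ℤ ] + β ≡ (α - [ 1ℤ ]) * (α - [ A ])
    1+β≡[α-1]*[α-A] = ⟨,⟩-cong (solve (A ∷ [])) (solve (A ∷ []))

  0≤ᶜ-α-β : 0≤ᶜ α - β
  0≤ᶜ-α-β = subst 0≤ᶜ_ (sym α-β≡α+[α-A]) (0≤ᶜ-+ 0≤ᶜ-α 0≤ᶜ-α-A)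
    where
    α-β≡α+[α-A] : α - β ≡ α + (α - [ A ])
    α-β≡α+[α-A] = ⟨,⟩-cong (solve (A ∷ [])) (solve (A ∷ []))

  -- 2A (β − 1) ≥ A, since β ≥ 3/2
  0≤ᶜ-[2A][α-1]-s : ∀ {s} → s ℤ.≤ A → 0≤ᶜ [ A ℤ.+ A ] * (α - [ 1ℤ ]) - [ s ]
  0≤ᶜ-[2A][α-1]-s {s} s≤A = subst 0≤ᶜ_ (sym split) $
    0≤ᶜ-+ (0≤ᶜ-* (0≤ᶜ-[] 0≤A)
                 (0≤ᶜ-* 0≤ᶜ-α-A
                   (0≤ᶜ-+ (0≤ᶜ-* 0≤ᶜ-α-1 0≤ᶜ-α-1) (0≤ᶜ-* (0≤ᶜ-[] (ℤP.i≤j⇒0≤j-i 1≤A)) 0≤ᶜ-α))))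
          (0≤ᶜ-[] (ℤP.i≤j⇒0≤j-i s≤A))
    where
    split : [ A ℤ.+ A ] * (α - [ 1ℤ ]) - [ s ]
            ≡ [ A ] * ((α - [ A ]) * ((α - [ 1ℤ ]) * (α - [ 1ℤ ]) + [ A ℤ.- 1ℤ ] * α)) + [ A ℤ.- s ]
    split = ⟨,⟩-cong (solve xs) (solve xs)
      where xs = A ∷ s ∷ []

  α-*-mixed : ∀ {m k t} → + suc m ℤ.+ A ℤ.* -[1+ k ] ≡ t → α * ⟨ + suc m , -[1+ k ] ⟩ ≡ ⟨ -[1+ k ] , t ⟩
  α-*-mixed {m} {k} eq = trans (α-* (+ suc m) -[1+ k ]) (cong ⟨ -[1+ k ] ,_⟩ eq)

  -- Multiplying by α sends ⟨ 1+m , −1−k ⟩ either to an element whose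
  -- coordinates have one sign, or to −⟨ 1+k , −1−t ⟩ with t < m.
  0≤ᶜ-dichotomy-mixed : ∀ fuel m k → m ℕ.+ k ℕ.< fuel →
                        0≤ᶜ ⟨ + suc m , -[1+ k ] ⟩ ⊎ 0≤ᶜ - ⟨ + suc m , -[1+ k ] ⟩
  0≤ᶜ-dichotomy-mixed (suc fuel) m k m+k<1+fuel
    with + suc m ℤ.+ A ℤ.* -[1+ k ] in eq
  ... | + zero   = inj₂ (0≤ᶜ-α⁻¹-neg (α-*-mixed eq) (cone⇒0≤ᶜ (+≤+ z≤n , +≤+ z≤n)))
  ... | -[1+ _ ] = inj₂ (0≤ᶜ-α⁻¹-neg (α-*-mixed eq) (cone⇒0≤ᶜ (+≤+ z≤n , +≤+ z≤n)))
  ... | + suc t  with 0≤ᶜ-dichotomy-mixed fuel k t k+t<fuel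
    where
    t<m : t ℕ.< m
    t<m = ℤP.drop‿+≤+ $ begin
      + suc t                        ≡⟨ eq ⟨
      + suc m ℤ.+ A ℤ.* -[1+ k ]     ≤⟨ ℤP.+-monoʳ-≤ (+ suc m) (ℤP.*-monoʳ-≤-nonPos -[1+ k ] 1≤A) ⟩
      + suc m ℤ.+ 1ℤ ℤ.* -[1+ k ]    ≡⟨ cong (λ i → + suc m ℤ.+ i) (ℤP.*-identityˡ -[1+ k ]) ⟩
      suc m ℤ.⊖ suc k                ≡⟨ ℤP.[1+m]⊖[1+n]≡m⊖n m k ⟩
      m ℤ.⊖ k                        ≤⟨ ℤP.m⊖n≤m m k ⟩
      + m                            ∎
      where open ℤP.≤-Reasoning
    k+t<fuel : k ℕ.+ t ℕ.< fuel
    k+t<fuel = ℕP.<-≤-trans (ℕP.+-monoʳ-< k t<m) (subst (ℕ._≤ fuel) (ℕP.+-comm m k) (ℕ.s≤s⁻¹ m+k<1+fuel))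
  ... | inj₁ p = inj₂ (0≤ᶜ-α⁻¹-neg (α-*-mixed eq) p)
  ... | inj₂ p = inj₁ (0≤ᶜ-α⁻¹ (α-*-mixed eq) p)

  0≤ᶜ-dichotomy : ∀ W → 0≤ᶜ W ⊎ 0≤ᶜ - W
  0≤ᶜ-dichotomy ⟨ + _      , + _      ⟩ = inj₁ (cone⇒0≤ᶜ (+≤+ z≤n , +≤+ z≤n))
  0≤ᶜ-dichotomy ⟨ + zero   , -[1+ _ ] ⟩ = inj₂ (cone⇒0≤ᶜ (+≤+ z≤n , +≤+ z≤n))
  0≤ᶜ-dichotomy ⟨ -[1+ _ ] , + zero   ⟩ = inj₂ (cone⇒0≤ᶜ (+≤+ z≤n , +≤+ z≤n))
  0≤ᶜ-dichotomy ⟨ -[1+ _ ] , -[1+ _ ] ⟩ = inj₂ (cone⇒0≤ᶜ (+≤+ z≤n , +≤+ z≤n))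
  0≤ᶜ-dichotomy ⟨ + suc m  , -[1+ k ] ⟩ = 0≤ᶜ-dichotomy-mixed (suc (m ℕ.+ k)) m k ℕP.≤-refl
  0≤ᶜ-dichotomy ⟨ -[1+ m ] , + suc k  ⟩ = swap (0≤ᶜ-dichotomy-mixed (suc (m ℕ.+ k)) m k ℕP.≤-refl)

  0≤-+ : ∀ {W V} → 0≤ W → 0≤ V → 0≤ W + V
  0≤-+ {W} {V} (by-σ p) (by-σ q) = by-σ (subst 0≤ᶜ_ (sym (σ-+ W V)) (0≤ᶜ-+ p q))

  0≤-* : ∀ {W V} → 0≤ W → 0≤ V → 0≤ W * V
  0≤-* {W} {V} (by-σ p) (by-σ q) = by-σ (subst 0≤ᶜ_ (sym (σ-* W V)) (0≤ᶜ-* p q))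

  0≤-[] : ∀ {c} → 0ℤ ℤ.≤ c → 0≤ [ c ]
  0≤-[] {c} 0≤c = by-σ (subst 0≤ᶜ_ (sym (σ-[] c)) (0≤ᶜ-[] 0≤c))

  0≤-dichotomy : ∀ W → 0≤ W ⊎ 0≤ - W
  0≤-dichotomy W with 0≤ᶜ-dichotomy (σ W)
  ... | inj₁ p = inj₁ (by-σ p)
  ... | inj₂ p = inj₂ (by-σ (subst 0≤ᶜ_ (sym (σ-neg W)) p))

  0≤-β : 0≤ β
  0≤-β = by-σ (subst 0≤ᶜ_ (sym σβ≡α) 0≤ᶜ-α)
    where
    σβ≡α : σ β ≡ α
    σβ≡α = ⟨,⟩-cong (solve (A ∷ [])) (solve (A ∷ []))

  0≤-β-1 : 0≤ β - [ 1ℤ ]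
  0≤-β-1 = by-σ (subst 0≤ᶜ_ (sym σ[β-1]≡α-1) 0≤ᶜ-α-1)
    where
    σ[β-1]≡α-1 : σ (β - [ 1ℤ ]) ≡ α - [ 1ℤ ]
    σ[β-1]≡α-1 = ⟨,⟩-cong (solve (A ∷ [])) (solve (A ∷ []))

  0≤-1+α : 0≤ [ 1ℤ ] + α
  0≤-1+α = by-σ (subst 0≤ᶜ_ (sym σ[1+α]≡1+β) 0≤ᶜ-1+β)
    where
    σ[1+α]≡1+β : σ ([ 1ℤ ] + α) ≡ [ 1ℤ ] + β
    σ[1+α]≡1+β = ⟨,⟩-cong (solve (A ∷ [])) (solve (A ∷ []))

  record Box (M : ℤ) (W : ℤα) : Set where
    field
      upper  : 0≤ [ M ] - W
      lower  : 0≤ [ M ] + W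
      upperᶜ : 0≤ᶜ [ M ] - W
      lowerᶜ : 0≤ᶜ [ M ] + W

  -- W + σ W = 2x + A y and (α − β)(W − σ W) = Δ y are integers, bounded
  -- through the two embeddings of W; they determine W.
  box-bounds : ∀ {M x y} → 0ℤ ℤ.≤ M → Box M ⟨ x , y ⟩ →
               Bounded (M ℤ.+ M) (+ 2 ℤ.* x ℤ.+ A ℤ.* y) ×
               Bounded ((M ℤ.+ M) ℤ.* (A ℤ.+ + 2)) (Δ ℤ.* y)
  box-bounds {M} {x} {y} 0≤M box =
    bounded (0≤ᶜ-integral (subst 0≤ᶜ_ tr-upper (0≤ᶜ-+ upperᶜ (σ-nonNeg upper))))
            (0≤ᶜ-integral (subst 0≤ᶜ_ tr-lower (0≤ᶜ-+ lowerᶜ (σ-nonNeg lower)))) ,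
    bounded (0≤ᶜ-integral (subst 0≤ᶜ_ Δy-upper
               (0≤ᶜ-+ (0≤ᶜ-* 0≤ᶜ-α-β (0≤ᶜ-+ upperᶜ (σ-nonNeg lower))) scaled)))
            (0≤ᶜ-integral (subst 0≤ᶜ_ Δy-lower
               (0≤ᶜ-+ (0≤ᶜ-* 0≤ᶜ-α-β (0≤ᶜ-+ lowerᶜ (σ-nonNeg upper))) scaled)))
    where
    open Box box
    scaled : 0≤ᶜ [ M ℤ.+ M ] * ([ + 2 ] * ([ 1ℤ ] + β))
    scaled = 0≤ᶜ-* (0≤ᶜ-[] (+-nonNeg 0≤M 0≤M)) (0≤ᶜ-* (0≤ᶜ-[] {+ 2} (+≤+ z≤n)) 0≤ᶜ-1+β)
    xs = A ∷ M ∷ x ∷ y ∷ []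
    tr-upper : [ M ] - ⟨ x , y ⟩ + σ ([ M ] - ⟨ x , y ⟩) ≡ [ M ℤ.+ M ℤ.- (+ 2 ℤ.* x ℤ.+ A ℤ.* y) ]
    tr-upper = ⟨,⟩-cong (solve xs) (solve xs)
    tr-lower : [ M ] + ⟨ x , y ⟩ + σ ([ M ] + ⟨ x , y ⟩) ≡ [ M ℤ.+ M ℤ.+ (+ 2 ℤ.* x ℤ.+ A ℤ.* y) ]
    tr-lower = ⟨,⟩-cong (solve xs) (solve xs)
    Δy-upper : (α - β) * ([ M ] - ⟨ x , y ⟩ + σ ([ M ] + ⟨ x , y ⟩)) + [ M ℤ.+ M ] * ([ + 2 ] * ([ 1ℤ ] + β))
               ≡ [ (M ℤ.+ M) ℤ.* (A ℤ.+ + 2) ℤ.- (A ℤ.* A ℤ.+ + 4) ℤ.* y ]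
    Δy-upper = ⟨,⟩-cong (solve xs) (solve xs)
    Δy-lower : (α - β) * ([ M ] + ⟨ x , y ⟩ + σ ([ M ] - ⟨ x , y ⟩)) + [ M ℤ.+ M ] * ([ + 2 ] * ([ 1ℤ ] + β))
               ≡ [ (M ℤ.+ M) ℤ.* (A ℤ.+ + 2) ℤ.+ (A ℤ.* A ℤ.+ + 4) ℤ.* y ]
    Δy-lower = ⟨,⟩-cong (solve xs) (solve xs)

-- Bounded search, finite codes and repetition

module _ {P Q : ℕ → Set} (decide : ∀ n → P n ⊎ Q n) where

  first : ℕ → ℕ → ℕ
  first k zero    = k
  first k (suc m) with decide k
  ... | inj₁ _ = k
  ... | inj₂ _ = first (suc k) m

  first≤ : ∀ k m → first k m ≤ k ℕ.+ m
  first≤ k zero    = ℕP.m≤m+n k 0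
  first≤ k (suc m) with decide k
  ... | inj₁ _ = ℕP.m≤m+n k (suc m)
  ... | inj₂ _ = subst (first (suc k) m ≤_) (sym (ℕP.+-suc k m)) (first≤ (suc k) m)

  first-satisfies : ∀ k m → P (k ℕ.+ m) → P (first k m)
  first-satisfies k zero    p = subst P (ℕP.+-identityʳ k) p
  first-satisfies k (suc m) p with decide k
  ... | inj₁ pk = pk
  ... | inj₂ _  = first-satisfies (suc k) m (subst P (ℕP.+-suc k m) p)

  first-minimal : ∀ k m → first k m ≡ k ⊎ Σ ℕ λ n → first k m ≡ suc n × Q n
  first-minimal k zero    = inj₁ refl
  first-minimal k (suc m) with decide k
  ... | inj₁ _  = inj₁ refl
  ... | inj₂ qk with first-minimal (suc k) m
  ...   | inj₁ first≡1+k = inj₂ (k , first≡1+k , qk)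
  ...   | inj₂ earlier   = inj₂ earlier

boundedCode : ∀ {c t} → Bounded c t → Fin (suc ∣ c ℤ.+ c ∣)
boundedCode {c} {t} (bounded 0≤c-t 0≤c+t) = fromℕ< (s≤s (begin
  ∣ c ℤ.+ t ∣                   ≤⟨ ℕP.m≤m+n _ _ ⟩
  ∣ c ℤ.+ t ∣ ℕ.+ ∣ c ℤ.- t ∣   ≡⟨ cong ∣_∣ sum ⟩
  ∣ c ℤ.+ c ∣                   ∎))
  where
  open ℕP.≤-Reasoning
  sum : + ∣ c ℤ.+ t ∣ ℤ.+ + ∣ c ℤ.- t ∣ ≡ c ℤ.+ c
  sum = trans (cong₂ ℤ._+_ (ℤP.0≤i⇒+∣i∣≡i 0≤c+t) (ℤP.0≤i⇒+∣i∣≡i 0≤c-t)) (solve (c ∷ t ∷ []))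

toℕ-boundedCode : ∀ {c t} (b : Bounded c t) → toℕ (boundedCode b) ≡ ∣ c ℤ.+ t ∣
toℕ-boundedCode _ = FinP.toℕ-fromℕ< _

boundedCode-injective : ∀ {c t t′} (b : Bounded c t) (b′ : Bounded c t′) →
                        boundedCode b ≡ boundedCode b′ → t ≡ t′
boundedCode-injective {c} {t} {t′} b@(bounded _ 0≤c+t) b′@(bounded _ 0≤c+t′) eq = +-cancelˡ c t t′ (begin
  c ℤ.+ t         ≡⟨ ℤP.0≤i⇒+∣i∣≡i 0≤c+t ⟨
  + ∣ c ℤ.+ t ∣   ≡⟨ cong +_ (trans (sym (toℕ-boundedCode b)) (trans (cong toℕ eq) (toℕ-boundedCode b′))) ⟩
  + ∣ c ℤ.+ t′ ∣  ≡⟨ ℤP.0≤i⇒+∣i∣≡i 0≤c+t′ ⟩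
  c ℤ.+ t′        ∎)
  where open ≡-Reasoning

flagCode : Bool → Fin 2
flagCode false = Fin.zero
flagCode true  = Fin.suc Fin.zero

flagCode-injective : ∀ {f g} → flagCode f ≡ flagCode g → f ≡ g
flagCode-injective {false} {false} _ = refl
flagCode-injective {true}  {true}  _ = refl

repetition : ∀ {m} {X : Set} (u : ℕ → X) (code : ℕ → Fin m) →
             (∀ i j → code i ≡ code j → u i ≡ u j) →
             Σ ℕ λ k → Σ ℕ λ p → 1 ≤ p × u (p ℕ.+ k) ≡ u k
repetition {m} u code code-injective with FinP.pigeonhole (ℕP.n<1+n m) (code ∘ toℕ)
... | i , j , i<j , eq =
  toℕ i , toℕ j ∸ toℕ i , ℕP.m<n⇒0<n∸m i<j ,
  trans (cong u (ℕP.m∸n+n≡m (ℕP.<⇒≤ i<j))) (sym (code-injective _ _ eq))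

fold-eventually-periodic : ∀ {X : Set} (x : X) (f : X → X) {k p} → fold x f (p ℕ.+ k) ≡ fold x f k →
                           ∀ n → k ≤ n → fold x f (n ℕ.+ p) ≡ fold x f n
fold-eventually-periodic x f {k} {p} eq n k≤n = begin
  fold x f (n ℕ.+ p)                ≡⟨ cong (fold x f) n+p≡t+[p+k] ⟩
  fold x f (t ℕ.+ (p ℕ.+ k))        ≡⟨ fold-+ x f t ⟩
  fold (fold x f (p ℕ.+ k)) f t     ≡⟨ cong (λ y → fold y f t) eq ⟩
  fold (fold x f k) f t             ≡⟨ fold-+ x f t ⟨
  fold x f (t ℕ.+ k)                ≡⟨ cong (fold x f) (ℕP.m∸n+n≡m k≤n) ⟩
  fold x f n                        ∎
  where
  open ≡-Reasoning
  t = n ∸ k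
  n+p≡t+[p+k] : n ℕ.+ p ≡ t ℕ.+ (p ℕ.+ k)
  n+p≡t+[p+k] = begin
    n ℕ.+ p               ≡⟨ cong (ℕ._+ p) (ℕP.m∸n+n≡m k≤n) ⟨
    t ℕ.+ k ℕ.+ p         ≡⟨ ℕP.+-assoc t k p ⟩
    t ℕ.+ (k ℕ.+ p)       ≡⟨ cong (t ℕ.+_) (ℕP.+-comm k p) ⟩
    t ℕ.+ (p ℕ.+ k)       ∎

-- The digit map

-- Z stands for D z, z the current remainder: step s Z = D (z − s) / α (as
-- 1/α = −β), and 0 ≤ slack s Z means that the next remainder is ≥ −1.
module DigitMap (A D : ℤ) where

  open Arithmetic A

  slack : ℤ → ℤα → ℤα
  slack s Z = [ D ] * ([ s ] - α) - Z

  step : ℤ → ℤα → ℤα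
  step s Z = β * ([ D ℤ.* s ] - Z)

  Z≡Ds+α*step : ∀ s Z → Z ≡ [ D ℤ.* s ] + α * step s Z
  Z≡Ds+α*step s ⟨ x , y ⟩ = ⟨,⟩-cong (solve xs) (solve xs)
    where xs = A ∷ D ∷ s ∷ x ∷ y ∷ []

  step+D : ∀ s Z → step s Z + [ D ] ≡ β * slack s Z
  step+D s ⟨ x , y ⟩ = ⟨,⟩-cong (solve xs) (solve xs)
    where xs = A ∷ D ∷ s ∷ x ∷ y ∷ []

  slack-step-zero : ∀ Z → slack A (step 0ℤ Z) ≡ β * (Z + [ D ])
  slack-step-zero ⟨ x , y ⟩ = ⟨,⟩-cong (solve xs) (solve xs)
    where xs = A ∷ D ∷ x ∷ y ∷ []

  slack-step-suc : ∀ s Z → slack (A ℤ.- 1ℤ) (step (1ℤ ℤ.+ s) Z) ≡ β * - slack s Z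
  slack-step-suc s ⟨ x , y ⟩ = ⟨,⟩-cong (solve xs) (solve xs)
    where xs = A ∷ D ∷ s ∷ x ∷ y ∷ []

  KD-step : ∀ K s Z → [ K ℤ.* D ] - step s Z
                      ≡ (α - [ A ]) * ([ K ℤ.* D ] - Z + [ D ] * ([ K ] * (α - [ 1ℤ ]) + [ s ]))
  KD-step K s ⟨ x , y ⟩ = ⟨,⟩-cong (solve xs) (solve xs)
    where xs = A ∷ D ∷ K ∷ s ∷ x ∷ y ∷ []

  step+KD : ∀ K s Z → step s Z + [ K ℤ.* D ]
                      ≡ (α - [ A ]) * (Z + [ K ℤ.* D ] + [ D ] * ([ K ] * (α - [ 1ℤ ]) - [ s ]))
  step+KD K s ⟨ x , y ⟩ = ⟨,⟩-cong (solve xs) (solve xs)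
    where xs = A ∷ D ∷ K ∷ s ∷ x ∷ y ∷ []

  slack-A : ∀ N → slack A [ N ] ≡ [ D ℤ.- N ] + [ D ] * (β - [ 1ℤ ])
  slack-A N = ⟨,⟩-cong (solve xs) (solve xs)
    where xs = A ∷ D ∷ N ∷ []

  [K+1]D-Z : ∀ K s Z → [ (K ℤ.+ 1ℤ) ℤ.* D ] - Z ≡ slack s Z + [ D ] * ([ K ℤ.- s ] + ([ 1ℤ ] + α))
  [K+1]D-Z K s ⟨ x , y ⟩ = ⟨,⟩-cong (solve xs) (solve xs)
    where xs = A ∷ D ∷ K ∷ s ∷ x ∷ y ∷ []

  [K+1]D+Z : ∀ K Z → [ (K ℤ.+ 1ℤ) ℤ.* D ] + Z ≡ Z + [ D ] + [ K ℤ.* D ]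
  [K+1]D+Z K ⟨ x , y ⟩ = ⟨,⟩-cong (solve xs) (solve xs)
    where xs = D ∷ K ∷ x ∷ y ∷ []

  [K+1]D-Zᶜ : ∀ K Z → [ (K ℤ.+ 1ℤ) ℤ.* D ] - Z ≡ [ K ℤ.* D ] - Z + [ D ]
  [K+1]D-Zᶜ K ⟨ x , y ⟩ = ⟨,⟩-cong (solve xs) (solve xs)
    where xs = D ∷ K ∷ x ∷ y ∷ []

  [K+1]D+Zᶜ : ∀ K Z → [ (K ℤ.+ 1ℤ) ℤ.* D ] + Z ≡ Z + [ K ℤ.* D ] + [ D ]
  [K+1]D+Zᶜ K ⟨ x , y ⟩ = ⟨,⟩-cong (solve xs) (solve xs)
    where xs = D ∷ K ∷ x ∷ y ∷ []

  telescope : (Z : ℕ → ℤα) (s : ℕ → ℕ) → (∀ t → Z t ≡ [ D ℤ.* + s t ] + α * Z (suc t)) →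
              ∀ m n → Z m ≡ [ D ] * sumDigits s m n + α^ n * Z (m ℕ.+ n)
  telescope Z s Z-spec m zero = begin
    Z m                                     ≡⟨ unit (Z m) ⟩
    [ D ] * [ 0ℤ ] + [ 1ℤ ] * Z m           ≡⟨ cong (λ k → [ D ] * [ 0ℤ ] + [ 1ℤ ] * Z k) (ℕP.+-identityʳ m) ⟨
    [ D ] * [ 0ℤ ] + [ 1ℤ ] * Z (m ℕ.+ 0)   ∎
    where
    open ≡-Reasoning
    unit : ∀ W → W ≡ [ D ] * [ 0ℤ ] + [ 1ℤ ] * W
    unit ⟨ x , y ⟩ = ⟨,⟩-cong (solve xs) (solve xs)
      where xs = A ∷ D ∷ x ∷ y ∷ []
  telescope Z s Z-spec m (suc n) = begin
    Z m                                                           ≡⟨ telescope Z s Z-spec m n ⟩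
    [ D ] * S + α^ n * Z (m ℕ.+ n)                                ≡⟨ cong (λ W → [ D ] * S + α^ n * W) (Z-spec (m ℕ.+ n)) ⟩
    [ D ] * S + α^ n * ([ D ℤ.* c ] + α * Z (suc (m ℕ.+ n)))      ≡⟨ shift S (α^ n) c (Z (suc (m ℕ.+ n))) ⟩
    [ D ] * (S + [ c ] * α^ n) + α^ n * α * Z (suc (m ℕ.+ n))
      ≡⟨ cong (λ k → [ D ] * (S + [ c ] * α^ n) + α^ suc n * Z k) (ℕP.+-suc m n) ⟨
    [ D ] * sumDigits s m (suc n) + α^ suc n * Z (m ℕ.+ suc n)    ∎
    where
    open ≡-Reasoning
    S = sumDigits s m n
    c = + s (m ℕ.+ n)
    shift : ∀ S P c W → [ D ] * S + P * ([ D ℤ.* c ] + α * W) ≡ [ D ] * (S + [ c ] * P) + P * α * W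
    shift ⟨ u , v ⟩ ⟨ p , r ⟩ c ⟨ x , y ⟩ = ⟨,⟩-cong (solve xs) (solve xs)
      where xs = A ∷ D ∷ u ∷ v ∷ p ∷ r ∷ c ∷ x ∷ y ∷ []

  periodic-sum : ∀ {Z₀ Zₖ Sₖ Sₚ U V} → Z₀ ≡ [ D ] * Sₖ + V * Zₖ → Zₖ ≡ [ D ] * Sₚ + U * Zₖ →
                 ([ 1ℤ ] - U) * Z₀ ≡ [ D ] * (([ 1ℤ ] - U) * Sₖ + V * Sₚ)
  periodic-sum {Z₀} {Zₖ} {Sₖ} {Sₚ} {U} {V} Z₀-spec Zₖ-spec = begin
    ([ 1ℤ ] - U) * Z₀                                 ≡⟨ cong (([ 1ℤ ] - U) *_) Z₀-spec ⟩
    ([ 1ℤ ] - U) * ([ D ] * Sₖ + V * Zₖ)              ≡⟨ expand U Sₖ V Zₖ ⟩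
    [ D ] * (([ 1ℤ ] - U) * Sₖ) + V * (Zₖ - U * Zₖ)   ≡⟨ cong (λ W → [ D ] * (([ 1ℤ ] - U) * Sₖ) + V * W) fixed ⟩
    [ D ] * (([ 1ℤ ] - U) * Sₖ) + V * ([ D ] * Sₚ)    ≡⟨ collect (([ 1ℤ ] - U) * Sₖ) V Sₚ ⟩
    [ D ] * (([ 1ℤ ] - U) * Sₖ + V * Sₚ)              ∎
    where
    open ≡-Reasoning
    expand : ∀ U S V W → ([ 1ℤ ] - U) * ([ D ] * S + V * W) ≡ [ D ] * (([ 1ℤ ] - U) * S) + V * (W - U * W)
    expand ⟨ u , u′ ⟩ ⟨ p , p′ ⟩ ⟨ v , v′ ⟩ ⟨ x , y ⟩ = ⟨,⟩-cong (solve xs) (solve xs)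
      where xs = A ∷ D ∷ u ∷ u′ ∷ p ∷ p′ ∷ v ∷ v′ ∷ x ∷ y ∷ []
    cancel : ∀ S U W → [ D ] * S + U * W - U * W ≡ [ D ] * S
    cancel ⟨ p , p′ ⟩ ⟨ u , u′ ⟩ ⟨ x , y ⟩ = ⟨,⟩-cong (solve xs) (solve xs)
      where xs = A ∷ D ∷ p ∷ p′ ∷ u ∷ u′ ∷ x ∷ y ∷ []
    collect : ∀ X V S → [ D ] * X + V * ([ D ] * S) ≡ [ D ] * (X + V * S)
    collect ⟨ p , p′ ⟩ ⟨ v , v′ ⟩ ⟨ x , y ⟩ = ⟨,⟩-cong (solve xs) (solve xs)
      where xs = A ∷ D ∷ p ∷ p′ ∷ v ∷ v′ ∷ x ∷ y ∷ []
    fixed : Zₖ - U * Zₖ ≡ [ D ] * Sₚ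
    fixed = trans (cong (_- U * Zₖ) Zₖ-spec) (cancel Sₚ U Zₖ)

-- From ℤ[α] to ℚ(α)

numerator-lower : ∀ {N d′} .{c : Coprime ∣ N ∣ (suc d′)} → ℚ.- 1ℚ ℚ.< mkℚ N d′ c → ℤ.- + suc d′ ℤ.≤ N
numerator-lower (*<* lt) = subst₂ ℤ._≤_ (ℤP.-1*i≡-i _) (ℤP.*-identityʳ _) (ℤP.<⇒≤ lt)

numerator-upper : ∀ {N d′} .{c : Coprime ∣ N ∣ (suc d′)} → mkℚ N d′ c ℚ.< 1ℚ → N ℤ.≤ + suc d′
numerator-upper (*<* lt) = subst₂ ℤ._≤_ (ℤP.*-identityʳ _) (ℤP.*-identityˡ _) (ℤP.<⇒≤ lt)

fromℤ-+ : ∀ i j → fromℤ (i ℤ.+ j) ≡ fromℤ i ℚ.+ fromℤ j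
fromℤ-+ i j = trans (sym (ℚP.↥p/↧p≡p (fromℤ (i ℤ.+ j))))
                    (cong (ℚ._/ 1) (cong₂ ℤ._+_ (sym (ℤP.*-identityʳ i)) (sym (ℤP.*-identityʳ j))))

fromℤ-* : ∀ i j → fromℤ (i ℤ.* j) ≡ fromℤ i ℚ.* fromℤ j
fromℤ-* i j = sym (ℚP.↥p/↧p≡p (fromℤ (i ℤ.* j)))

fromℤ-neg : ∀ i → fromℤ (ℤ.- i) ≡ ℚ.- fromℤ i
fromℤ-neg (+ zero) = refl
fromℤ-neg +[1+ _ ] = refl
fromℤ-neg -[1+ _ ] = refl

natQ≡fromℤ : ∀ a n → natQ a n ≡ fromℤ (+ n)
natQ≡fromℤ _ n = ℚP.↥p/↧p≡p (fromℤ (+ n))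

fromℤ-*-mkℚ : ∀ {u N d′ r} .{c : Coprime ∣ N ∣ (suc d′)} → u ℤ.* N ≡ + suc d′ ℤ.* r →
              fromℤ u ℚ.* mkℚ N d′ c ≡ fromℤ r
fromℤ-*-mkℚ {u} {N} {d′} {r} uN≡Dr =
  trans (ℚP.fromℚᵘ-cong {mkℚᵘ (u ℤ.* N) (d′ ℕ.+ 0)} {mkℚᵘ r 0} (*≡* cross)) (ℚP.↥p/↧p≡p (fromℤ r))
  where
  open ≡-Reasoning
  cross : u ℤ.* N ℤ.* + 1 ≡ r ℤ.* + suc (d′ ℕ.+ 0)
  cross = begin
    u ℤ.* N ℤ.* + 1           ≡⟨ ℤP.*-identityʳ (u ℤ.* N) ⟩
    u ℤ.* N                   ≡⟨ uN≡Dr ⟩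
    + suc d′ ℤ.* r            ≡⟨ ℤP.*-comm (+ suc d′) r ⟩
    r ℤ.* + suc d′            ≡⟨ cong (λ n → r ℤ.* + suc n) (ℕP.+-identityʳ d′) ⟨
    r ℤ.* + suc (d′ ℕ.+ 0)    ∎

module Transfer (a : ℕ) where

  open Arithmetic (+ a)

  toQA : ℤα → QA
  toQA ⟨ x , y ⟩ = fromℤ x , fromℤ y

  toQA-+ : ∀ W V → toQA (W + V) ≡ _⊕_ a (toQA W) (toQA V)
  toQA-+ ⟨ x , y ⟩ ⟨ u , v ⟩ = cong₂ _,_ (fromℤ-+ x u) (fromℤ-+ y v)

  toQA-- : ∀ W V → toQA (W - V) ≡ _⊖_ a (toQA W) (toQA V)
  toQA-- ⟨ x , y ⟩ ⟨ u , v ⟩ =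
    cong₂ _,_ (trans (fromℤ-+ x (ℤ.- u)) (cong (fromℤ x ℚ.+_) (fromℤ-neg u)))
              (trans (fromℤ-+ y (ℤ.- v)) (cong (fromℤ y ℚ.+_) (fromℤ-neg v)))

  toQA-* : ∀ W V → toQA (W * V) ≡ _⊗_ a (toQA W) (toQA V)
  toQA-* ⟨ x , y ⟩ ⟨ u , v ⟩ = cong₂ _,_
    (trans (fromℤ-+ (x ℤ.* u) (y ℤ.* v)) (cong₂ ℚ._+_ (fromℤ-* x u) (fromℤ-* y v)))
    (trans (fromℤ-+ (x ℤ.* v ℤ.+ y ℤ.* u) (+ a ℤ.* (y ℤ.* v))) (cong₂ ℚ._+_
      (trans (fromℤ-+ (x ℤ.* v) (y ℤ.* u)) (cong₂ ℚ._+_ (fromℤ-* x v) (fromℤ-* y u)))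
      (trans (fromℤ-* (+ a) (y ℤ.* v)) (cong₂ ℚ._*_ (sym (natQ≡fromℤ a a)) (fromℤ-* y v)))))

  toQA-α^ : ∀ n → toQA (α^ n) ≡ αpow a n
  toQA-α^ zero    = refl
  toQA-α^ (suc n) = trans (toQA-* (α^ n) α) (cong (λ W → _⊗_ a W (αQ a)) (toQA-α^ n))

  toQA-sumDigits : ∀ s m n → toQA (sumDigits s m n) ≡ digitSum a s m n
  toQA-sumDigits s m zero    = refl
  toQA-sumDigits s m (suc n) = begin
    toQA (sumDigits s m n + [ c ] * α^ n)                         ≡⟨ toQA-+ (sumDigits s m n) ([ c ] * α^ n) ⟩
    _⊕_ a (toQA (sumDigits s m n)) (toQA ([ c ] * α^ n))
      ≡⟨ cong₂ (_⊕_ a) (toQA-sumDigits s m n) (toQA-* [ c ] (α^ n)) ⟩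
    _⊕_ a (digitSum a s m n) (_⊗_ a (toQA [ c ]) (toQA (α^ n)))
      ≡⟨ cong₂ (λ x W → _⊕_ a (digitSum a s m n) (_⊗_ a (x , 0ℚ) W))
               (sym (natQ≡fromℤ a (s (m ℕ.+ n)))) (toQA-α^ n) ⟩
    digitSum a s m (suc n)                                        ∎
    where
    open ≡-Reasoning
    c = + s (m ℕ.+ n)

  toQA-*-mkℚ : ∀ {N d′} .{c : Coprime ∣ N ∣ (suc d′)} U R → U * [ N ] ≡ [ + suc d′ ] * R →
               _⊗_ a (toQA U) (embed a (mkℚ N d′ c)) ≡ toQA R
  toQA-*-mkℚ {N} {d′} {c} ⟨ u , v ⟩ ⟨ r , t ⟩ UN≡DR = cong₂ _,_
    (begin
      fromℤ u ℚ.* q ℚ.+ fromℤ v ℚ.* 0ℚ                 ≡⟨ cong (fromℤ u ℚ.* q ℚ.+_) (ℚP.*-zeroʳ (fromℤ v)) ⟩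
      fromℤ u ℚ.* q ℚ.+ 0ℚ                              ≡⟨ ℚP.+-identityʳ _ ⟩
      fromℤ u ℚ.* q                                     ≡⟨ fromℤ-*-mkℚ {u} {N} {d′} {r} {c} (proj₁ coordinatewise) ⟩
      fromℤ r                                           ∎)
    (begin
      fromℤ u ℚ.* 0ℚ ℚ.+ fromℤ v ℚ.* q ℚ.+ natQ a a ℚ.* (fromℤ v ℚ.* 0ℚ)
        ≡⟨ cong₂ (λ x y → x ℚ.+ fromℤ v ℚ.* q ℚ.+ natQ a a ℚ.* y)
                 (ℚP.*-zeroʳ (fromℤ u)) (ℚP.*-zeroʳ (fromℤ v)) ⟩
      0ℚ ℚ.+ fromℤ v ℚ.* q ℚ.+ natQ a a ℚ.* 0ℚ          ≡⟨ cong (0ℚ ℚ.+ fromℤ v ℚ.* q ℚ.+_) (ℚP.*-zeroʳ (natQ a a)) ⟩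
      0ℚ ℚ.+ fromℤ v ℚ.* q ℚ.+ 0ℚ                       ≡⟨ ℚP.+-identityʳ _ ⟩
      0ℚ ℚ.+ fromℤ v ℚ.* q                              ≡⟨ ℚP.+-identityˡ _ ⟩
      fromℤ v ℚ.* q                                     ≡⟨ fromℤ-*-mkℚ {v} {N} {d′} {t} {c} (proj₂ coordinatewise) ⟩
      fromℤ t                                           ∎)
    where
    open ≡-Reasoning
    q = mkℚ N d′ c
    coordinatewise : u ℤ.* N ≡ + suc d′ ℤ.* r × v ℤ.* N ≡ + suc d′ ℤ.* t
    coordinatewise = ⟨,⟩-injective (trans (sym (*-[] u v N)) (trans UN≡DR ([]-* (+ suc d′) r t)))

  ev-periodic-sum : ∀ {N d′} .{c : Coprime ∣ N ∣ (suc d′)} s k p →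
    ([ 1ℤ ] - α^ p) * [ N ] ≡ [ + suc d′ ] * (([ 1ℤ ] - α^ p) * sumDigits s 0 k + α^ k * sumDigits s k p) →
    EvPeriodicSumIs a s k p (embed a (mkℚ N d′ c))
  ev-periodic-sum {N} {d′} {c} s k p expansion = begin
    _⊗_ a (_⊖_ a (embed a 1ℚ) (αpow a p)) q        ≡⟨ cong (λ X → _⊗_ a X q) unit-part ⟨
    _⊗_ a (toQA U) q                                ≡⟨ toQA-*-mkℚ {c = c} U (U * Sₖ + α^ k * Sₚ) expansion ⟩
    toQA (U * Sₖ + α^ k * Sₚ)                       ≡⟨ toQA-+ (U * Sₖ) (α^ k * Sₚ) ⟩
    _⊕_ a (toQA (U * Sₖ)) (toQA (α^ k * Sₚ))        ≡⟨ cong₂ (_⊕_ a) (toQA-* U Sₖ) (toQA-* (α^ k) Sₚ) ⟩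
    _⊕_ a (_⊗_ a (toQA U) (toQA Sₖ)) (_⊗_ a (toQA (α^ k)) (toQA Sₚ))
      ≡⟨ cong₂ (_⊕_ a) (cong₂ (_⊗_ a) unit-part (toQA-sumDigits s 0 k))
                       (cong₂ (_⊗_ a) (toQA-α^ k) (toQA-sumDigits s k p)) ⟩
    _⊕_ a (_⊗_ a (_⊖_ a (embed a 1ℚ) (αpow a p)) (digitSum a s 0 k))
          (_⊗_ a (αpow a k) (digitSum a s k p))     ∎
    where
    open ≡-Reasoning
    q = embed a (mkℚ N d′ c)
    U = [ 1ℤ ] - α^ p
    Sₖ = sumDigits s 0 k
    Sₚ = sumDigits s k p
    unit-part : toQA U ≡ _⊖_ a (embed a 1ℚ) (αpow a p)
    unit-part = trans (toQA-- [ 1ℤ ] (α^ p)) (cong (_⊖_ a (embed a 1ℚ)) (toQA-α^ p))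

-- The expansion of N / D

module Expansion (a′ d′ : ℕ) (N : ℤ) (-D≤N : ℤ.- + suc d′ ℤ.≤ N) (N≤D : N ℤ.≤ + suc d′) where

  a : ℕ
  a = suc a′

  -- K bounds the remainder under α ↦ β; it works because K (β − 1) ≥ a.
  A D K : ℤ
  A = + a
  D = + suc d′
  K = A ℤ.+ A

  open Arithmetic A
  open Positivity A (+≤+ (s≤s z≤n))
  open DigitMap A D

  -- the flag says whether the last digit was nonzero; if so the next one is < a
  State : Set
  State = ℤα × Bool

  fuel : Bool → ℕ
  fuel false = a
  fuel true  = a′

  fuel≤a : ∀ f → fuel f ≤ a
  fuel≤a false = ℕP.≤-refl
  fuel≤a true  = ℕP.n≤1+n a′

  nonZero : ℕ → Bool
  nonZero zero    = false
  nonZero (suc _) = true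

  digit : State → ℕ
  digit (Z , f) = first (λ s → 0≤-dichotomy (slack (+ s) Z)) 0 (fuel f)

  next : State → State
  next S@(Z , _) = step (+ digit S) Z , nonZero (digit S)

  orbit : ℕ → State
  orbit = fold ([ N ] , false) next

  digits : ℕ → ℕ
  digits t = digit (orbit t)

  record Invariant (Z : ℤα) (f : Bool) : Set where
    field
      lower  : 0≤ Z + [ D ]
      upper  : 0≤ slack (+ fuel f) Z
      lowerᶜ : 0≤ᶜ Z + [ K ℤ.* D ]
      upperᶜ : 0≤ᶜ [ K ℤ.* D ] - Z

  0≤ᶜ-D : 0≤ᶜ [ D ]
  0≤ᶜ-D = 0≤ᶜ-[] (+≤+ z≤n)

  D≤KD : D ℤ.≤ K ℤ.* D
  D≤KD = subst (ℤ._≤ K ℤ.* D) (ℤP.*-identityˡ D) (ℤP.*-monoʳ-≤-nonNeg D {1ℤ} {K} (+≤+ (s≤s z≤n)))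

  invariant-init : Invariant [ N ] false
  invariant-init = record
    { lower  = 0≤-[] (ℤP.i≤j⇒0≤j-i -D≤N)
    ; upper  = subst 0≤_ (sym (slack-A N))
                 (0≤-+ (0≤-[] (ℤP.i≤j⇒0≤j-i N≤D)) (0≤-* (0≤-[] {D} (+≤+ z≤n)) 0≤-β-1))
    ; lowerᶜ = 0≤ᶜ-[] (ℤP.≤-trans (ℤP.i≤j⇒0≤j-i -D≤N) (ℤP.+-monoʳ-≤ N D≤KD))
    ; upperᶜ = 0≤ᶜ-[] (ℤP.i≤j⇒0≤j-i (ℤP.≤-trans N≤D D≤KD))
    }

  lower-step : ∀ {s Z} → 0≤ slack s Z → 0≤ step s Z + [ D ]
  lower-step {s} {Z} room = subst 0≤_ (sym (step+D s Z)) (0≤-* 0≤-β room)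

  upper-step : ∀ {Z} s → 0≤ Z + [ D ] → (s ≡ 0 ⊎ Σ ℕ λ s′ → s ≡ suc s′ × 0≤ - slack (+ s′) Z) →
               0≤ slack (+ fuel (nonZero s)) (step (+ s) Z)
  upper-step {Z} _ lower (inj₁ refl) = subst 0≤_ (sym (slack-step-zero Z)) (0≤-* 0≤-β lower)
  upper-step {Z} _ _ (inj₂ (s′ , refl , too-small)) =
    subst 0≤_ (sym (slack-step-suc (+ s′) Z)) (0≤-* 0≤-β too-small)

  lowerᶜ-step : ∀ {s Z} → s ℤ.≤ A → 0≤ᶜ Z + [ K ℤ.* D ] → 0≤ᶜ step s Z + [ K ℤ.* D ]
  lowerᶜ-step {s} {Z} s≤A lowerᶜ = subst 0≤ᶜ_ (sym (step+KD K s Z))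
    (0≤ᶜ-* 0≤ᶜ-α-A (0≤ᶜ-+ lowerᶜ (0≤ᶜ-* 0≤ᶜ-D (0≤ᶜ-[2A][α-1]-s s≤A))))

  upperᶜ-step : ∀ {s Z} → 0ℤ ℤ.≤ s → 0≤ᶜ [ K ℤ.* D ] - Z → 0≤ᶜ [ K ℤ.* D ] - step s Z
  upperᶜ-step {s} {Z} 0≤s upperᶜ = subst 0≤ᶜ_ (sym (KD-step K s Z))
    (0≤ᶜ-* 0≤ᶜ-α-A (0≤ᶜ-+ upperᶜ
      (0≤ᶜ-* 0≤ᶜ-D (0≤ᶜ-+ (0≤ᶜ-* (0≤ᶜ-[] {K} (+≤+ z≤n)) 0≤ᶜ-α-1) (0≤ᶜ-[] 0≤s)))))

  invariant-next : ∀ {Z f} → Invariant Z f → uncurry Invariant (next (Z , f))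
  invariant-next {Z} {f} inv = record
    { lower  = lower-step (first-satisfies decide 0 (fuel f) upper)
    ; upper  = upper-step (digit (Z , f)) lower (first-minimal decide 0 (fuel f))
    ; lowerᶜ = lowerᶜ-step (+≤+ (ℕP.≤-trans (first≤ decide 0 (fuel f)) (fuel≤a f))) lowerᶜ
    ; upperᶜ = upperᶜ-step (+≤+ z≤n) upperᶜ
    }
    where
    open Invariant inv
    decide = λ s → 0≤-dichotomy (slack (+ s) Z)

  invariant-orbit : ∀ t → uncurry Invariant (orbit t)
  invariant-orbit zero    = invariant-init
  invariant-orbit (suc t) = invariant-next (invariant-orbit t)

  M : ℤ
  M = (K ℤ.+ 1ℤ) ℤ.* D

  invariant⇒box : ∀ {Z f} → Invariant Z f → Box M Z
  invariant⇒box {Z} {f} inv = record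
    { upper  = subst 0≤_ (sym ([K+1]D-Z K (+ fuel f) Z))
                 (0≤-+ upper (0≤-* (0≤-[] {D} (+≤+ z≤n)) (0≤-+ (0≤-[] 0≤K-fuel) 0≤-1+α)))
    ; lower  = subst 0≤_ (sym ([K+1]D+Z K Z)) (0≤-+ lower (0≤-[] (+≤+ z≤n)))
    ; upperᶜ = subst 0≤ᶜ_ (sym ([K+1]D-Zᶜ K Z)) (0≤ᶜ-+ upperᶜ 0≤ᶜ-D)
    ; lowerᶜ = subst 0≤ᶜ_ (sym ([K+1]D+Zᶜ K Z)) (0≤ᶜ-+ lowerᶜ 0≤ᶜ-D)
    }
    where
    open Invariant inv
    0≤K-fuel : 0ℤ ℤ.≤ K ℤ.- + fuel f
    0≤K-fuel = ℤP.i≤j⇒0≤j-i (+≤+ (ℕP.≤-trans (fuel≤a f) (ℕP.m≤m+n a a)))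

  0≤M : 0ℤ ℤ.≤ M
  0≤M = +≤+ z≤n

  Code : Set
  Code = Fin (suc ∣ (M ℤ.+ M) ℤ.+ (M ℤ.+ M) ∣ ℕ.* (suc ∣ C ℤ.+ C ∣ ℕ.* 2))
    where C = (M ℤ.+ M) ℤ.* (A ℤ.+ + 2)

  code : (S : State) → Box M (proj₁ S) → Code
  code (⟨ x , y ⟩ , f) box =
    combine (boundedCode (proj₁ bounds)) (combine (boundedCode (proj₂ bounds)) (flagCode f))
    where bounds = box-bounds 0≤M box

  code-injective : ∀ S S′ (B : Box M (proj₁ S)) (B′ : Box M (proj₁ S′)) → code S B ≡ code S′ B′ → S ≡ S′
  code-injective (⟨ x , y ⟩ , f) (⟨ x′ , y′ ⟩ , f′) B B′ eq =
    cong₂ _,_ (coordinates-injective (boundedCode-injective tr tr′ (FinP.combine-injectiveˡ _ rest _ rest′ eq))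
                                     (boundedCode-injective Δy Δy′ (FinP.combine-injectiveˡ _ _ _ _ rest≡)))
              (flagCode-injective (FinP.combine-injectiveʳ (boundedCode Δy) _ (boundedCode Δy′) _ rest≡))
    where
    tr  = proj₁ (box-bounds 0≤M B)
    Δy  = proj₂ (box-bounds 0≤M B)
    tr′ = proj₁ (box-bounds 0≤M B′)
    Δy′ = proj₂ (box-bounds 0≤M B′)
    rest  = combine (boundedCode Δy) (flagCode f)
    rest′ = combine (boundedCode Δy′) (flagCode f′)
    rest≡ : rest ≡ rest′
    rest≡ = FinP.combine-injectiveʳ (boundedCode tr) rest (boundedCode tr′) rest′ eq

  orbit-repeats : Σ ℕ λ k → Σ ℕ λ p → 1 ≤ p × orbit (p ℕ.+ k) ≡ orbit k
  orbit-repeats = repetition orbit (λ t → code (orbit t) (box t))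
                    (λ i j → code-injective (orbit i) (orbit j) (box i) (box j))
    where
    box : ∀ t → Box M (proj₁ (orbit t))
    box t = invariant⇒box (invariant-orbit t)

  k p : ℕ
  k = proj₁ orbit-repeats
  p = proj₁ (proj₂ orbit-repeats)

  orbit-periodic : ∀ n → k ≤ n → orbit (n ℕ.+ p) ≡ orbit n
  orbit-periodic = fold-eventually-periodic _ next (proj₂ (proj₂ (proj₂ orbit-repeats)))

  digits-periodic : EventuallyPeriodic a digits k p
  digits-periodic = proj₁ (proj₂ (proj₂ orbit-repeats)) , λ n k≤n → cong digit (orbit-periodic n k≤n)

  digit≤fuel : ∀ S → digit S ≤ fuel (proj₂ S)
  digit≤fuel (Z , f) = first≤ (λ s → 0≤-dichotomy (slack (+ s) Z)) 0 (fuel f)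

  digits≤a : Digits a digits
  digits≤a t = ℕP.≤-trans (digit≤fuel (orbit t)) (fuel≤a _)

  digits-admissible : WeaklyAdmissible a digits
  digits-admissible j = after-nonZero (digits j) (digit≤fuel (orbit (suc j)))
    where
    after-nonZero : ∀ s {t} → t ≤ fuel (nonZero s) → t ≡ a → s ≡ 0
    after-nonZero zero    _    _    = refl
    after-nonZero (suc _) t≤a′ refl = ⊥-elim (ℕP.1+n≰n t≤a′)

  remainder : ℕ → ℤα
  remainder t = proj₁ (orbit t)

  expansion : ([ 1ℤ ] - α^ p) * [ N ]
              ≡ [ D ] * (([ 1ℤ ] - α^ p) * sumDigits digits 0 k + α^ k * sumDigits digits k p)
  expansion = periodic-sum (telescope remainder digits remainder-spec 0 k)
    (trans (telescope remainder digits remainder-spec k p)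
           (cong (λ Z → [ D ] * sumDigits digits k p + α^ p * Z) (cong proj₁ (orbit-periodic k ℕP.≤-refl))))
    where
    remainder-spec : ∀ t → remainder t ≡ [ D ℤ.* + digits t ] + α * remainder (suc t)
    remainder-spec t = Z≡Ds+α*step (+ digits t) (remainder t)

-- opened only here, as -_ would clash with the negation of ℤα
open import Data.Rational using (_<_; -_)

mainTheorem2 : (a : ℕ) → 1 ≤ a → (q : ℚ) → (- 1ℚ) < q → q < 1ℚ →
    Σ (ℕ → ℕ) λ s → Σ ℕ λ k → Σ ℕ λ p →
      Digits a s × WeaklyAdmissible a s × EventuallyPeriodic a s k p
        × EvPeriodicSumIs a s k p (embed a q)
mainTheorem2 (suc a′) (s≤s z≤n) (mkℚ N d′ _) -1<q q<1 =
  digits , k , p , digits≤a , digits-admissible , digits-periodic ,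
  Transfer.ev-periodic-sum (suc a′) digits k p expansion
  where open Expansion a′ d′ N (numerator-lower -1<q) (numerator-upper q<1)
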